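{- Given a $\Sigma^0_2$ set $U$ of finite binary strings, there exists a monotone machine $N$ such that for every $X\in2^\omega$, $N(X)$ is infinite if and only if $X$ has no prefix in $U$.
   Context: A monotone machine is a partial computable function $N$ from finite binary strings to finite binary strings such that if $\sigma\preceq\tau$ and $N(\sigma),N(\tau)$ are both defined then $N(\sigma)\preceq N(\tau)$ ($\preceq$ the prefix relation); for $X\in2^\omega$, $N(X)$ is the supremum of the $N(\sigma)$ for $\sigma$ a prefix of $X$. A set of strings is $\Sigma^0_2$ if definable by a $\Sigma^0_2$ formula of arithmetic. -}

module Defs where

open import Data.Nat using (ℕ; zero; suc; _+_; _*_; _≤_)
open import Data.Fin using (Fin)
open import Data.Bool using (Bool; true; false)
open import Data.List using (List; []; _∷_; _++_; length)
open import Data.Vec using (Vec; []; _∷_; lookup)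
open import Data.Maybe using (Maybe; just; nothing; _>>=_)
open import Data.Product using (Σ; ∃; _×_; _,_)
open import Relation.Binary.PropositionalEquality using (_≡_)
open import Relation.Nullary using (¬_)
open import Function.Bundles using (_⇔_)

data PR : ℕ → Set where
  Z    : ∀ {k} → PR k
  S    : PR 1
  proj : ∀ {k} → Fin k → PR k
  comp : ∀ {m k} → PR m → Vec (PR k) m → PR k
  prec : ∀ {k} → PR k → PR (suc (suc k)) → PR (suc k)
  mu   : ∀ {k} → PR (suc k) → PR k

-- Fuel-bounded evaluation.  Any 'just' result is the true value;
-- the function converges iff some amount of fuel suffices.
mutual
  eval : ∀ {k} → ℕ → PR k → Vec ℕ k → Maybe ℕ
  eval zero    _          _               = nothing
  eval (suc n) Z          xs              = just 0
  eval (suc n) S          (x ∷ [])        = just (suc x)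
  eval (suc n) (proj i)   xs              = just (lookup xs i)
  eval (suc n) (comp f gs) xs             = evalVec n gs xs >>= eval n f
  eval (suc n) (prec f g) (zero ∷ xs)     = eval n f xs
  eval (suc n) (prec f g) (suc y ∷ xs)    =
    eval n (prec f g) (y ∷ xs) >>= λ r → eval n g (y ∷ r ∷ xs)
  eval (suc n) (mu f)     xs              = muSearch n f xs 0 n

  evalVec : ∀ {m k} → ℕ → Vec (PR k) m → Vec ℕ k → Maybe (Vec ℕ m)
  evalVec n []       xs = just []
  evalVec n (g ∷ gs) xs =
    eval n g xs >>= λ y → evalVec n gs xs >>= λ ys → just (y ∷ ys)

  muSearch : ∀ {k} → ℕ → PR (suc k) → Vec ℕ k → ℕ → ℕ → Maybe ℕ
  muSearch n f xs i zero    = nothing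
  muSearch n f xs i (suc c) = eval n f (i ∷ xs) >>= λ
    { zero    → just i
    ; (suc _) → muSearch n f xs (suc i) c }

_⟨_⟩↓_ : ∀ {k} → PR k → Vec ℕ k → ℕ → Set
f ⟨ xs ⟩↓ y = ∃ λ fuel → eval fuel f xs ≡ just y

Total : ∀ {k} → PR k → Set
Total f = ∀ xs → ∃ λ y → f ⟨ xs ⟩↓ y

-- Finite binary strings, coded bijectively as natural numbers:
-- [] ↦ 0, b ∷ σ ↦ 2·code σ + 1 + [b].

Str : Set
Str = List Bool

encode : Str → ℕ
encode []          = 0
encode (false ∷ σ) = suc (2 * encode σ)
encode (true ∷ σ)  = suc (suc (2 * encode σ))

_⪯_ : Str → Str → Set
σ ⪯ τ = ∃ λ ρ → σ ++ ρ ≡ τ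

Cantor : Set
Cantor = ℕ → Bool

_↾_ : Cantor → ℕ → Str
X ↾ zero  = []
X ↾ suc n = (X ↾ n) ++ (X n ∷ [])

_[_]↓_ : PR 1 → Str → Str → Set
e [ σ ]↓ τ = e ⟨ encode σ ∷ [] ⟩↓ encode τ

record MonotoneMachine : Set where
  field
    code     : PR 1
    monotone : ∀ {σ τ a b} → σ ⪯ τ → code [ σ ]↓ a → code [ τ ]↓ b → a ⪯ b

-- N(X) = sup of N(σ), σ ≺ X, is infinite: (by monotonicity) the lengths
-- of the outputs on prefixes of X are unbounded.
OutputInfinite : MonotoneMachine → Cantor → Set
OutputInfinite N X =
  ∀ k → ∃ λ n → ∃ λ τ → (MonotoneMachine.code N [ X ↾ n ]↓ τ) × (k ≤ length τ)

-- Σ⁰₂ sets of strings (Kleene normal form):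
-- σ ∈ U ⇔ ∃ n ∀ m R(σ, n, m), R a total computable relation
-- (R(σ,n,m) holds iff the total function takes value 0).

IsΣ⁰₂ : (Str → Set) → Set
IsΣ⁰₂ U = Σ (PR 3) λ R → Total R ×
  (∀ σ → U σ ⇔ (∃ λ n → ∀ m → R ⟨ encode σ ∷ n ∷ m ∷ [] ⟩↓ 0))

NoPrefixIn : (Str → Set) → Cantor → Set
NoPrefixIn U X = ∀ n → ¬ U (X ↾ n)

module Submission where

-- On input σ the machine outputs a string of length g(σ), the number of stages k < |σ| at which,
-- for every prefix of σ of length i ≤ k and every candidate witness n ≤ k for "σ↾i ∈ U", a
-- counterexample m < code(σ) to the universal part of the Σ⁰₂ definition has been found.
-- Extending σ only adds counterexamples, so g is monotone and the machine is monotone.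
-- If X↾i ∈ U with witness w, no stage ≥ i + w is ever cleared along X, so N(X) is finite.
-- If X has no prefix in U, every pair (i, n) has a counterexample (classically), and a
-- long enough prefix of X clears any given number of stages.

open import Defs
open import Level using (0ℓ)
open import Axiom.ExcludedMiddle using (ExcludedMiddle)
open import Data.Bool using (Bool; true; false)
open import Data.Empty using (⊥-elim)
open import Data.Fin using (Fin; zero; suc; #_)
open import Data.List using ([]; _∷_; _++_; length; take; drop; replicate)
open import Data.List.Properties
  using (length-++; length-++-≤ˡ; length-drop; length-take; length-replicate; take++drop≡id; take-all; drop-all; drop-drop; ++-assoc; ++-identityʳ)
open import Data.Maybe using (Maybe; just; _>>=_)
open import Data.Maybe.Properties using (just-injective)
open import Data.Nat using (ℕ; zero; suc; pred; _+_; _*_; _∸_; _^_; _⊔_; _≤_; _<_; _≤′_; ≤′-refl; ≤′-step; _≤?_; z≤n; s≤s; ⌊_/2⌋; ⌈_/2⌉)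
open import Data.Nat.Properties
open import Data.Nat.Solver using (module +-*-Solver)
open import Data.Product using (Σ; ∃; _×_; _,_; proj₁; proj₂)
open import Data.Sum using (inj₁; inj₂)
open import Data.Vec using (Vec; []; _∷_; lookup; tabulate)
open import Data.Vec.Properties using (tabulate∘lookup)
open import Data.Vec.N-ary using (_$ⁿ_)
open import Function.Base using (case_of_)
open import Function.Bundles using (_⇔_; mk⇔; Equivalence)
open import Relation.Binary.PropositionalEquality
open import Relation.Nullary using (¬_; yes; no)

>>=-just-inv : ∀ {A B : Set} (m : Maybe A) {k : A → Maybe B} {y} →
  (m >>= k) ≡ just y → ∃ λ v → m ≡ just v × k v ≡ just y
>>=-just-inv (just v) e = v , refl , e

mutual
  eval-suc : ∀ {k} n (f : PR k) xs {y} → eval n f xs ≡ just y → eval (suc n) f xs ≡ just y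
  eval-suc (suc n) Z xs e = e
  eval-suc (suc n) S (x ∷ []) e = e
  eval-suc (suc n) (proj i) xs e = e
  eval-suc (suc n) (comp f gs) xs e with >>=-just-inv (evalVec n gs xs) e
  ... | v , e₁ , e₂ rewrite evalVec-suc n gs xs e₁ = eval-suc n f v e₂
  eval-suc (suc n) (prec f g) (zero ∷ xs) e = eval-suc n f xs e
  eval-suc (suc n) (prec f g) (suc y ∷ xs) e with >>=-just-inv (eval n (prec f g) (y ∷ xs)) e
  ... | r , e₁ , e₂ rewrite eval-suc n (prec f g) (y ∷ xs) e₁ = eval-suc n g _ e₂
  eval-suc (suc n) (mu f) xs e = muSearch-suc n f xs 0 n e

  evalVec-suc : ∀ {m k} n (gs : Vec (PR k) m) xs {ys} →
    evalVec n gs xs ≡ just ys → evalVec (suc n) gs xs ≡ just ys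
  evalVec-suc n [] xs e = e
  evalVec-suc n (g ∷ gs) xs e with >>=-just-inv (eval n g xs) e
  ... | v , e₁ , e₂ with >>=-just-inv (evalVec n gs xs) e₂
  ... | vs , e₃ , e₄ rewrite eval-suc n g xs e₁ | evalVec-suc n gs xs e₃ = e₄

  muSearch-suc : ∀ {k} n (f : PR (suc k)) xs i c {y} →
    muSearch n f xs i c ≡ just y → muSearch (suc n) f xs i (suc c) ≡ just y
  muSearch-suc n f xs i (suc c) e with >>=-just-inv (eval n f (i ∷ xs)) e
  ... | zero  , e₁ , e₂ rewrite eval-suc n f (i ∷ xs) e₁ = e₂
  ... | suc _ , e₁ , e₂ rewrite eval-suc n f (i ∷ xs) e₁ = muSearch-suc n f xs (suc i) c e₂

just-persists : ∀ {A : Set} (f : ℕ → Maybe A) → (∀ n {y} → f n ≡ just y → f (suc n) ≡ just y) →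
  ∀ {m n y} → m ≤ n → f m ≡ just y → f n ≡ just y
just-persists f step m≤n e = go (≤⇒≤′ m≤n)
  where
  go : ∀ {n} → _ ≤′ n → f n ≡ just _
  go ≤′-refl         = e
  go (≤′-step m≤′n) = step _ (go m≤′n)

eval-≤ : ∀ {k m n} (f : PR k) {xs y} → m ≤ n → eval m f xs ≡ just y → eval n f xs ≡ just y
eval-≤ f {xs} = just-persists (λ n → eval n f xs) (λ n → eval-suc n f xs)

evalVec-≤ : ∀ {k l m n} (gs : Vec (PR k) l) {xs ys} → m ≤ n → evalVec m gs xs ≡ just ys → evalVec n gs xs ≡ just ys
evalVec-≤ gs {xs} = just-persists (λ n → evalVec n gs xs) (λ n → evalVec-suc n gs xs)

↓-functional : ∀ {k} (f : PR k) {xs a b} → f ⟨ xs ⟩↓ a → f ⟨ xs ⟩↓ b → a ≡ b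
↓-functional f (m , eₘ) (n , eₙ) =
  just-injective (trans (sym (eval-≤ f (m≤m⊔n m n) eₘ)) (eval-≤ f (m≤n⊔m m n) eₙ))

record Computable (k : ℕ) (F : Vec ℕ k → ℕ) : Set where
  field
    program : PR k
    runs    : ∀ xs → program ⟨ xs ⟩↓ F xs
open Computable

data Computables (k : ℕ) : ∀ {m} → (Vec ℕ k → Vec ℕ m) → Set where
  []  : Computables k (λ _ → [])
  _∷_ : ∀ {m F} {G : Vec ℕ k → Vec ℕ m} → Computable k F → Computables k G → Computables k (λ xs → F xs ∷ G xs)

programs : ∀ {k m} {G : Vec ℕ k → Vec ℕ m} → Computables k G → Vec (PR k) m
programs []       = []
programs (f ∷ fs) = program f ∷ programs fs

programs-run : ∀ {k m} {G : Vec ℕ k → Vec ℕ m} (fs : Computables k G) xs →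
  ∃ λ n → evalVec n (programs fs) xs ≡ just (G xs)
programs-run []       xs = 0 , refl
programs-run (f ∷ fs) xs with runs f xs | programs-run fs xs
... | a , fa | b , fsb = a ⊔ b , (begin
  (eval (a ⊔ b) (program f) xs >>= λ y → evalVec (a ⊔ b) (programs fs) xs >>= λ ys → just (y ∷ ys))
    ≡⟨ cong (_>>= _) (eval-≤ (program f) (m≤m⊔n a b) fa) ⟩
  (evalVec (a ⊔ b) (programs fs) xs >>= λ ys → just (_ ∷ ys))
    ≡⟨ cong (_>>= _) (evalVec-≤ (programs fs) (m≤n⊔m a b) fsb) ⟩
  just (_ ∷ _) ∎)
  where open ≡-Reasoning

computable-ext : ∀ {k} {F G : Vec ℕ k → ℕ} → (∀ xs → F xs ≡ G xs) → Computable k F → Computable k G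
computable-ext F≗G f = record
  { program = program f
  ; runs    = λ xs → subst (program f ⟨ xs ⟩↓_) (F≗G xs) (runs f xs) }

zeroᶜ : ∀ {k} → Computable k (λ _ → 0)
zeroᶜ = record { program = Z ; runs = λ _ → 1 , refl }

sucᶜ : Computable 1 (λ { (x ∷ []) → suc x })
sucᶜ = record { program = S ; runs = λ { (x ∷ []) → 1 , refl } }

πᶜ : ∀ {k} (i : Fin k) → Computable k (λ xs → lookup xs i)
πᶜ i = record { program = proj i ; runs = λ _ → 1 , refl }

infixr 9 _∘ᶜ_
_∘ᶜ_ : ∀ {k m} {F : Vec ℕ m → ℕ} {G : Vec ℕ k → Vec ℕ m} →
  Computable m F → Computables k G → Computable k (λ xs → F (G xs))
_∘ᶜ_ {F = F} {G} f gs = record { program = comp (program f) (programs gs) ; runs = run }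
  where
  run : ∀ xs → comp (program f) (programs gs) ⟨ xs ⟩↓ F (G xs)
  run xs with programs-run gs xs | runs f (G xs)
  ... | a , gsa | b , fb = suc (a ⊔ b) , (begin
    (evalVec (a ⊔ b) (programs gs) xs >>= eval (a ⊔ b) (program f))
      ≡⟨ cong (_>>= _) (evalVec-≤ (programs gs) (m≤m⊔n a b) gsa) ⟩
    eval (a ⊔ b) (program f) (G xs)
      ≡⟨ eval-≤ (program f) (m≤n⊔m a b) fb ⟩
    just (F (G xs)) ∎)
    where open ≡-Reasoning

primRec : ∀ {k} → (Vec ℕ k → ℕ) → (Vec ℕ (suc (suc k)) → ℕ) → Vec ℕ (suc k) → ℕ
primRec F G (zero ∷ xs)  = F xs
primRec F G (suc y ∷ xs) = G (y ∷ primRec F G (y ∷ xs) ∷ xs)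

precᶜ : ∀ {k} {F : Vec ℕ k → ℕ} {G} → Computable k F → Computable (suc (suc k)) G → Computable (suc k) (primRec F G)
precᶜ {F = F} {G} f g = record { program = prec (program f) (program g) ; runs = run }
  where
  run : ∀ xs → prec (program f) (program g) ⟨ xs ⟩↓ primRec F G xs
  run (zero ∷ xs) with runs f xs
  ... | n , fn = suc n , fn
  run (suc y ∷ xs) with run (y ∷ xs) | runs g (y ∷ primRec F G (y ∷ xs) ∷ xs)
  ... | a , reca | b , gb = suc (a ⊔ b) , (begin
    (eval (a ⊔ b) (prec (program f) (program g)) (y ∷ xs) >>= λ r → eval (a ⊔ b) (program g) (y ∷ r ∷ xs))
      ≡⟨ cong (_>>= _) (eval-≤ (prec (program f) (program g)) (m≤m⊔n a b) reca) ⟩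
    eval (a ⊔ b) (program g) (y ∷ primRec F G (y ∷ xs) ∷ xs)
      ≡⟨ eval-≤ (program g) (m≤n⊔m a b) gb ⟩
    just (primRec F G (suc y ∷ xs)) ∎)
    where open ≡-Reasoning

recᶜ : ∀ {k} {F : Vec ℕ k → ℕ} {G} {H : Vec ℕ (suc k) → ℕ} → Computable k F → Computable (suc (suc k)) G →
  (∀ xs → H (zero ∷ xs) ≡ F xs) → (∀ y xs → H (suc y ∷ xs) ≡ G (y ∷ H (y ∷ xs) ∷ xs)) → Computable (suc k) H
recᶜ {F = F} {G} {H} f g base step = computable-ext agree (precᶜ f g)
  where
  agree : ∀ xs → primRec F G xs ≡ H xs
  agree (zero ∷ xs)  = sym (base xs)
  agree (suc y ∷ xs) = trans (cong (λ r → G (y ∷ r ∷ xs)) (agree (y ∷ xs))) (sym (step y xs))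

oneᶜ : ∀ {k} → Computable k (λ _ → 1)
oneᶜ = sucᶜ ∘ᶜ (zeroᶜ ∷ [])

+ᶜ : Computable 2 (λ { (x ∷ y ∷ []) → x + y })
+ᶜ = recᶜ (πᶜ (# 0)) (sucᶜ ∘ᶜ (πᶜ (# 1) ∷ [])) (λ { (y ∷ []) → refl }) (λ { x (y ∷ []) → refl })

*ᶜ : Computable 2 (λ { (x ∷ y ∷ []) → x * y })
*ᶜ = recᶜ zeroᶜ (+ᶜ ∘ᶜ (πᶜ (# 2) ∷ πᶜ (# 1) ∷ [])) (λ { (y ∷ []) → refl }) (λ { x (y ∷ []) → refl })

predᶜ : Computable 1 (λ { (x ∷ []) → pred x })
predᶜ = recᶜ zeroᶜ (πᶜ (# 0)) (λ { [] → refl }) (λ { y [] → refl })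

∸ᶜ : Computable 2 (λ { (x ∷ y ∷ []) → x ∸ y })
∸ᶜ = computable-ext (λ { (x ∷ y ∷ []) → refl }) (monus ∘ᶜ (πᶜ (# 1) ∷ πᶜ (# 0) ∷ []))
  where
  monus : Computable 2 (λ { (y ∷ x ∷ []) → x ∸ y })
  monus = recᶜ (πᶜ (# 0)) (predᶜ ∘ᶜ (πᶜ (# 1) ∷ []))
    (λ { (x ∷ []) → refl }) (λ { y (x ∷ []) → sym (pred[m∸n]≡m∸[1+n] x y) })

sg : ℕ → ℕ
sg zero    = 0
sg (suc _) = 1

sgᶜ : Computable 1 (λ { (x ∷ []) → sg x })
sgᶜ = recᶜ zeroᶜ oneᶜ (λ { [] → refl }) (λ { y [] → refl })

2^ᶜ : Computable 1 (λ { (x ∷ []) → 2 ^ x })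
2^ᶜ = recᶜ oneᶜ (+ᶜ ∘ᶜ (πᶜ (# 1) ∷ πᶜ (# 1) ∷ []))
  (λ { [] → refl }) (λ { x [] → cong (2 ^ x +_) (+-identityʳ (2 ^ x)) })

⌊1+n/2⌋≡n∸⌊n/2⌋ : ∀ n → ⌊ suc n /2⌋ ≡ n ∸ ⌊ n /2⌋
⌊1+n/2⌋≡n∸⌊n/2⌋ n = begin
  ⌈ n /2⌉                     ≡⟨ m+n∸m≡n ⌊ n /2⌋ ⌈ n /2⌉ ⟨
  ⌊ n /2⌋ + ⌈ n /2⌉ ∸ ⌊ n /2⌋ ≡⟨ cong (_∸ ⌊ n /2⌋) (⌊n/2⌋+⌈n/2⌉≡n n) ⟩
  n ∸ ⌊ n /2⌋                 ∎
  where open ≡-Reasoning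

⌊/2⌋ᶜ : Computable 1 (λ { (x ∷ []) → ⌊ x /2⌋ })
⌊/2⌋ᶜ = recᶜ zeroᶜ (∸ᶜ ∘ᶜ (πᶜ (# 0) ∷ πᶜ (# 1) ∷ []))
  (λ { [] → refl }) (λ { x [] → ⌊1+n/2⌋≡n∸⌊n/2⌋ x })

∑< : ℕ → (ℕ → ℕ) → ℕ
∑< zero    f = 0
∑< (suc b) f = ∑< b f + f b

syntax ∑< b (λ j → e) = ∑[ j < b ] e

lookupsᶜ : ∀ {k m} (h : Fin m → Fin k) → Computables k (λ xs → tabulate (λ i → lookup xs (h i)))
lookupsᶜ {m = zero}  h = []
lookupsᶜ {m = suc m} h = πᶜ (h zero) ∷ lookupsᶜ (λ i → h (suc i))

∑ᶜ : ∀ {k} {F : Vec ℕ (suc k) → ℕ} → Computable (suc k) F →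
  Computable (suc k) (λ { (b ∷ xs) → ∑[ j < b ] F (j ∷ xs) })
∑ᶜ {F = F} f = recᶜ zeroᶜ (+ᶜ ∘ᶜ (πᶜ (# 1) ∷ f ∘ᶜ (πᶜ (# 0) ∷ lookupsᶜ (λ i → suc (suc i))) ∷ []))
  (λ _ → refl) (λ b xs → cong (λ ys → ∑[ j < b ] F (j ∷ xs) + F (b ∷ ys)) (sym (tabulate∘lookup xs)))

tailCode : ℕ → ℕ
tailCode c = ⌊ pred c /2⌋

dropCode : ℕ → ℕ → ℕ
dropCode zero    c = c
dropCode (suc i) c = tailCode (dropCode i c)

-- By encode-++, subtracting the coded tail drop i σ, scaled by 2 ^ i, leaves the code of take i σ.
takeCode : ℕ → ℕ → ℕ
takeCode i c = c ∸ 2 ^ i * dropCode i c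

tailCodeᶜ : Computable 1 (λ { (c ∷ []) → tailCode c })
tailCodeᶜ = computable-ext (λ { (c ∷ []) → refl }) (⌊/2⌋ᶜ ∘ᶜ (predᶜ ∷ []))

dropCodeᶜ : Computable 2 (λ { (i ∷ c ∷ []) → dropCode i c })
dropCodeᶜ = recᶜ (πᶜ (# 0)) (tailCodeᶜ ∘ᶜ (πᶜ (# 1) ∷ [])) (λ { (c ∷ []) → refl }) (λ { i (c ∷ []) → refl })

takeCodeᶜ : Computable 2 (λ { (i ∷ c ∷ []) → takeCode i c })
takeCodeᶜ = computable-ext (λ { (i ∷ c ∷ []) → refl })
  (∸ᶜ ∘ᶜ (πᶜ (# 1) ∷ *ᶜ ∘ᶜ (2^ᶜ ∘ᶜ (πᶜ (# 0) ∷ []) ∷ dropCodeᶜ ∷ []) ∷ []))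

2*n≡n+n : ∀ n → 2 * n ≡ n + n
2*n≡n+n n = cong (n +_) (+-identityʳ n)

⌊2*n/2⌋≡n : ∀ n → ⌊ 2 * n /2⌋ ≡ n
⌊2*n/2⌋≡n n = trans (cong ⌊_/2⌋ (2*n≡n+n n)) (sym (n≡⌊n+n/2⌋ n))

⌊1+2*n/2⌋≡n : ∀ n → ⌊ suc (2 * n) /2⌋ ≡ n
⌊1+2*n/2⌋≡n n = begin
  ⌊ suc (2 * n) /2⌋       ≡⟨ ⌊1+n/2⌋≡n∸⌊n/2⌋ (2 * n) ⟩
  2 * n ∸ ⌊ 2 * n /2⌋     ≡⟨ cong₂ _∸_ (2*n≡n+n n) (⌊2*n/2⌋≡n n) ⟩
  n + n ∸ n               ≡⟨ m+n∸m≡n n n ⟩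
  n                       ∎
  where open ≡-Reasoning

tailCode-encode : ∀ σ → tailCode (encode σ) ≡ encode (drop 1 σ)
tailCode-encode []          = refl
tailCode-encode (false ∷ σ) = ⌊2*n/2⌋≡n (encode σ)
tailCode-encode (true ∷ σ)  = ⌊1+2*n/2⌋≡n (encode σ)

dropCode-encode : ∀ i σ → dropCode i (encode σ) ≡ encode (drop i σ)
dropCode-encode zero    σ = refl
dropCode-encode (suc i) σ = begin
  tailCode (dropCode i (encode σ))  ≡⟨ cong tailCode (dropCode-encode i σ) ⟩
  tailCode (encode (drop i σ))      ≡⟨ tailCode-encode (drop i σ) ⟩
  encode (drop 1 (drop i σ))        ≡⟨ cong encode (drop-drop i 1 σ) ⟩
  encode (drop (i + 1) σ)           ≡⟨ cong (λ j → encode (drop j σ)) (+-comm i 1) ⟩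
  encode (drop (suc i) σ)           ∎
  where open ≡-Reasoning

encode-++ : ∀ σ ρ → encode (σ ++ ρ) ≡ encode σ + 2 ^ length σ * encode ρ
encode-++ []          ρ = sym (+-identityʳ (encode ρ))
encode-++ (false ∷ σ) ρ rewrite encode-++ σ ρ =
  solve 3 (λ e p r → con 1 :+ con 2 :* (e :+ p :* r) := con 1 :+ con 2 :* e :+ con 2 :* p :* r) refl
    (encode σ) (2 ^ length σ) (encode ρ)
  where open +-*-Solver
encode-++ (true ∷ σ)  ρ rewrite encode-++ σ ρ =
  solve 3 (λ e p r → con 2 :+ con 2 :* (e :+ p :* r) := con 2 :+ con 2 :* e :+ con 2 :* p :* r) refl
    (encode σ) (2 ^ length σ) (encode ρ)
  where open +-*-Solver

takeCode-encode : ∀ i σ → i ≤ length σ → takeCode i (encode σ) ≡ encode (take i σ)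
takeCode-encode i σ i≤∣σ∣ = begin
  encode σ ∸ 2 ^ i * dropCode i (encode σ)  ≡⟨ cong (λ d → encode σ ∸ 2 ^ i * d) (dropCode-encode i σ) ⟩
  encode σ ∸ 2 ^ i * D                      ≡⟨ cong (λ c → c ∸ 2 ^ i * D) split ⟩
  encode (take i σ) + 2 ^ i * D ∸ 2 ^ i * D ≡⟨ m+n∸n≡m (encode (take i σ)) (2 ^ i * D) ⟩
  encode (take i σ)                         ∎
  where
  open ≡-Reasoning
  D = encode (drop i σ)
  split : encode σ ≡ encode (take i σ) + 2 ^ i * D
  split = begin
    encode σ                                            ≡⟨ cong encode (take++drop≡id i σ) ⟨
    encode (take i σ ++ drop i σ)                       ≡⟨ encode-++ (take i σ) (drop i σ) ⟩
    encode (take i σ) + 2 ^ length (take i σ) * D       ≡⟨ cong (λ l → encode (take i σ) + 2 ^ l * D)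
                                                             (trans (length-take i σ) (m≤n⇒m⊓n≡m i≤∣σ∣)) ⟩
    encode (take i σ) + 2 ^ i * D                       ∎

encode-mono : ∀ {σ τ} → σ ⪯ τ → encode σ ≤ encode τ
encode-mono {σ} (ρ , refl) = subst (encode σ ≤_) (sym (encode-++ σ ρ)) (m≤m+n _ _)

length≤encode : ∀ σ → length σ ≤ encode σ
length≤encode []          = z≤n
length≤encode (false ∷ σ) = s≤s (≤-trans (length≤encode σ) (m≤m+n _ _))
length≤encode (true ∷ σ)  = s≤s (≤-trans (≤-trans (length≤encode σ) (m≤m+n _ _)) (n≤1+n _))

encode-injective : ∀ σ τ → encode σ ≡ encode τ → σ ≡ τ
encode-injective []      []      _ = refl
encode-injective (a ∷ σ) (b ∷ τ) e with encode-injective σ τ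
  (trans (sym (tailCode-encode (a ∷ σ))) (trans (cong tailCode e) (tailCode-encode (b ∷ τ))))
encode-injective (false ∷ σ) (false ∷ σ) e | refl = refl
encode-injective (true ∷ σ)  (true ∷ σ)  e | refl = refl
encode-injective (false ∷ σ) (true ∷ σ)  e | refl = ⊥-elim (1+n≢n (sym (suc-injective e)))
encode-injective (true ∷ σ)  (false ∷ σ) e | refl = ⊥-elim (1+n≢n (suc-injective e))
encode-injective []      (false ∷ τ) ()
encode-injective []      (true ∷ τ)  ()
encode-injective (false ∷ σ) [] ()
encode-injective (true ∷ σ)  [] ()

encode-replicate : ∀ n → encode (replicate n false) ≡ 2 ^ n ∸ 1
encode-replicate zero    = refl
encode-replicate (suc n) = begin
  suc (2 * encode (replicate n false)) ≡⟨ cong (λ e → suc (2 * e)) (encode-replicate n) ⟩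
  suc (2 * (2 ^ n ∸ 1))                 ≡⟨ cong suc (*-distribˡ-∸ 2 (2 ^ n) 1) ⟩
  suc (2 * 2 ^ n ∸ 2)                   ≡⟨ +-∸-assoc 1 (*-monoʳ-≤ 2 (m^n>0 2 n)) ⟨
  2 * 2 ^ n ∸ 1                         ∎
  where open ≡-Reasoning

sg-encode : ∀ σ → 0 < length σ → sg (encode σ) ≡ 1
sg-encode (false ∷ σ) _ = refl
sg-encode (true ∷ σ)  _ = refl

dropCode-short : ∀ k σ → length σ ≤ k → dropCode k (encode σ) ≡ 0
dropCode-short k σ ∣σ∣≤k = trans (dropCode-encode k σ) (cong encode (drop-all k σ ∣σ∣≤k))

sg-dropCode-long : ∀ k σ → k < length σ → sg (dropCode k (encode σ)) ≡ 1
sg-dropCode-long k σ k<∣σ∣ = trans (cong sg (dropCode-encode k σ))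
  (sg-encode (drop k σ) (subst (0 <_) (sym (length-drop k σ)) (m<n⇒0<n∸m k<∣σ∣)))

∑<-monoˡ-≤ : ∀ f {b b′} → b ≤ b′ → ∑< b f ≤ ∑< b′ f
∑<-monoˡ-≤ f {b} b≤b′ = go (≤⇒≤′ b≤b′)
  where
  go : ∀ {b′} → b ≤′ b′ → ∑< b f ≤ ∑< b′ f
  go ≤′-refl        = ≤-refl
  go (≤′-step b≤′b′) = ≤-trans (go b≤′b′) (m≤m+n _ _)

∑<-monoʳ-≤ : ∀ {f g} b → (∀ j → j < b → f j ≤ g j) → ∑< b f ≤ ∑< b g
∑<-monoʳ-≤ zero    f≤g = z≤n
∑<-monoʳ-≤ (suc b) f≤g = +-mono-≤ (∑<-monoʳ-≤ b (λ j j<b → f≤g j (m<n⇒m<1+n j<b))) (f≤g b ≤-refl)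

term≤∑< : ∀ f {j b} → j < b → f j ≤ ∑< b f
term≤∑< f {b = suc b} j<1+b with m≤n⇒m<n∨m≡n (≤-pred j<1+b)
... | inj₁ j<b  = ≤-trans (term≤∑< f j<b) (m≤m+n _ _)
... | inj₂ refl = m≤n+m _ _

∑<-≡0 : ∀ {f} b → (∀ j → j < b → f j ≡ 0) → ∑< b f ≡ 0
∑<-≡0 zero    f≡0 = refl
∑<-≡0 (suc b) f≡0 = cong₂ _+_ (∑<-≡0 b (λ j j<b → f≡0 j (m<n⇒m<1+n j<b))) (f≡0 b ≤-refl)

∑<-≡bound : ∀ {f} b → (∀ j → j < b → f j ≡ 1) → ∑< b f ≡ b
∑<-≡bound zero    f≡1 = refl
∑<-≡bound (suc b) f≡1 =
  trans (cong₂ _+_ (∑<-≡bound b (λ j j<b → f≡1 j (m<n⇒m<1+n j<b))) (f≡1 b ≤-refl)) (+-comm b 1)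

∑<-≤bound : ∀ {f} b → (∀ j → f j ≤ 1) → ∑< b f ≤ b
∑<-≤bound zero    f≤1 = z≤n
∑<-≤bound {f} (suc b) f≤1 = subst (∑< b f + f b ≤_) (+-comm b 1) (+-mono-≤ (∑<-≤bound {f} b f≤1) (f≤1 b))

∑<-≤support : ∀ {f} M b → (∀ j → f j ≤ 1) → (∀ j → M ≤ j → f j ≡ 0) → ∑< b f ≤ M
∑<-≤support M zero    f≤1 f≡0 = z≤n
∑<-≤support {f} M (suc b) f≤1 f≡0 with M ≤? b
... | yes M≤b = subst (_≤ M) (sym (trans (cong (∑< b f +_) (f≡0 b M≤b)) (+-identityʳ _))) (∑<-≤support {f} M b f≤1 f≡0)
... | no  M≰b = ≤-trans (∑<-≤bound {f} (suc b) f≤1) (≰⇒> M≰b)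

sg≤1 : ∀ n → sg n ≤ 1
sg≤1 zero    = z≤n
sg≤1 (suc n) = ≤-refl

sg-mono : ∀ {m n} → m ≤ n → sg m ≤ sg n
sg-mono {zero}          _ = z≤n
sg-mono {suc m} {suc n} _ = ≤-refl

sg-pos : ∀ {n} → 0 < n → sg n ≡ 1
sg-pos {suc n} _ = refl

length-↾ : ∀ X n → length (X ↾ n) ≡ n
length-↾ X zero    = refl
length-↾ X (suc n) = trans (length-++ (X ↾ n)) (trans (cong (_+ 1) (length-↾ X n)) (+-comm n 1))

↾-⪯ : ∀ X {i l} → i ≤ l → (X ↾ i) ⪯ (X ↾ l)
↾-⪯ X {i} i≤l = go (≤⇒≤′ i≤l)
  where
  go : ∀ {l} → i ≤′ l → (X ↾ i) ⪯ (X ↾ l)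
  go ≤′-refl = [] , ++-identityʳ (X ↾ i)
  go {suc l} (≤′-step i≤′l) with go i≤′l
  ... | ρ , e = ρ ++ X l ∷ [] , trans (sym (++-assoc (X ↾ i) ρ (X l ∷ []))) (cong (_++ X l ∷ []) e)

take-⪯ : ∀ i {σ τ} → σ ⪯ τ → i ≤ length σ → take i τ ≡ take i σ
take-⪯ zero    _              _         = refl
take-⪯ (suc i) {b ∷ σ} (ρ , refl) (s≤s i≤∣σ∣) = cong (b ∷_) (take-⪯ i (ρ , refl) i≤∣σ∣)

take-↾ : ∀ X {i l} → i ≤ l → take i (X ↾ l) ≡ X ↾ i
take-↾ X {i} i≤l = trans (take-⪯ i (↾-⪯ X i≤l) (≤-reflexive (sym (length-↾ X i))))
                         (take-all i (X ↾ i) (≤-reflexive (length-↾ X i)))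

takeCode-↾ : ∀ X {i l} → i ≤ l → takeCode i (encode (X ↾ l)) ≡ encode (X ↾ i)
takeCode-↾ X {i} {l} i≤l =
  trans (takeCode-encode i (X ↾ l) (subst (i ≤_) (sym (length-↾ X l)) i≤l)) (cong encode (take-↾ X i≤l))

⪯-length : ∀ {σ τ} → σ ⪯ τ → length σ ≤ length τ
⪯-length {σ} (ρ , refl) = length-++-≤ˡ σ

replicate-⪯ : ∀ {m n} (x : Bool) → m ≤ n → replicate m x ⪯ replicate n x
replicate-⪯ {n = n} x z≤n = replicate n x , refl
replicate-⪯ x (s≤s m≤n) with replicate-⪯ x m≤n
... | ρ , e = ρ , cong (x ∷_) e

[]↓-functional : ∀ e {σ a b} → e [ σ ]↓ a → e [ σ ]↓ b → a ≡ b
[]↓-functional e ea eb = encode-injective _ _ (↓-functional e ea eb)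

module _ (e : PR 1) (f : Str → Str) (e↓f : ∀ σ → e [ σ ]↓ f σ) (f-mono : ∀ {σ τ} → σ ⪯ τ → f σ ⪯ f τ) where

  machine : MonotoneMachine
  machine = record
    { code     = e
    ; monotone = λ {σ} {τ} σ⪯τ ea eb →
        subst₂ _⪯_ ([]↓-functional e (e↓f σ) ea) ([]↓-functional e (e↓f τ) eb) (f-mono σ⪯τ) }

  machine-infinite⇔ : ∀ X → OutputInfinite machine X ⇔ (∀ k → ∃ λ n → k ≤ length (f (X ↾ n)))
  machine-infinite⇔ X = mk⇔
    (λ inf k → case inf k of λ { (n , τ , eτ , k≤∣τ∣) →
       n , subst (λ υ → k ≤ length υ) ([]↓-functional e eτ (e↓f (X ↾ n))) k≤∣τ∣ })
    (λ unbounded k → case unbounded k of λ { (n , k≤) → n , f (X ↾ n) , e↓f (X ↾ n) , k≤ })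

-- r a n m ≢ 0 says m is a counterexample to witness n for the string coded by a.
module Stages (r : ℕ → ℕ → ℕ → ℕ) where

  refuted : ℕ → ℕ → ℕ → ℕ
  refuted c i n = sg (∑[ m < c ] r (takeCode i c) n m)

  pending : ℕ → ℕ → ℕ
  pending c k = ∑[ i < suc k ] ∑[ n < suc k ] (1 ∸ refuted c i n)

  cleared : ℕ → ℕ → ℕ
  cleared c k = sg (dropCode k c) ∸ pending c k

  clearedBelow : ℕ → ℕ
  clearedBelow c = ∑[ k < c ] cleared c k

  cleared≤1 : ∀ c k → cleared c k ≤ 1
  cleared≤1 c k = ≤-trans (m∸n≤m (sg (dropCode k c)) (pending c k)) (sg≤1 (dropCode k c))

  cleared≡0-beyond : ∀ σ k → length σ ≤ k → cleared (encode σ) k ≡ 0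
  cleared≡0-beyond σ k ∣σ∣≤k = trans (cong (λ d → sg d ∸ pending (encode σ) k) (dropCode-short k σ ∣σ∣≤k))
                                  (0∸n≡0 (pending (encode σ) k))

  refuted≡0-noCounterexample : ∀ c i n → (∀ m → r (takeCode i c) n m ≡ 0) → refuted c i n ≡ 0
  refuted≡0-noCounterexample c i n none = cong sg (∑<-≡0 c (λ m _ → none m))

  refuted≡1-counterexample : ∀ {c i n m} → m < c → r (takeCode i c) n m ≢ 0 → refuted c i n ≡ 1
  refuted≡1-counterexample {c} {i} {n} m<c r≢0 = sg-pos (≤-trans (n≢0⇒n>0 r≢0) (term≤∑< (r (takeCode i c) n) m<c))

  refuted-mono : ∀ {c c′} i n → c ≤ c′ → takeCode i c ≡ takeCode i c′ → refuted c i n ≤ refuted c′ i n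
  refuted-mono {c} {c′} i n c≤c′ same = sg-mono (begin
    ∑[ m < c ] r (takeCode i c) n m   ≡⟨ cong (λ a → ∑[ m < c ] r a n m) same ⟩
    ∑[ m < c ] r (takeCode i c′) n m  ≤⟨ ∑<-monoˡ-≤ (r (takeCode i c′) n) c≤c′ ⟩
    ∑[ m < c′ ] r (takeCode i c′) n m ∎)
    where open ≤-Reasoning

  cleared≡0-unrefuted : ∀ c {i n k} → i ≤ k → n ≤ k → refuted c i n ≡ 0 → cleared c k ≡ 0
  cleared≡0-unrefuted c {i} {n} {k} i≤k n≤k unrefuted = m≤n⇒m∸n≡0 (≤-trans (sg≤1 (dropCode k c)) (begin
    1                                   ≡⟨ cong (1 ∸_) unrefuted ⟨
    1 ∸ refuted c i n                   ≤⟨ term≤∑< (λ n → 1 ∸ refuted c i n) (s≤s n≤k) ⟩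
    ∑[ n < suc k ] (1 ∸ refuted c i n)  ≤⟨ term≤∑< (λ i → ∑[ n < suc k ] (1 ∸ refuted c i n)) (s≤s i≤k) ⟩
    pending c k                         ∎))
    where open ≤-Reasoning

  cleared≡1-allRefuted : ∀ σ k → k < length σ →
    (∀ {i n} → i ≤ k → n ≤ k → refuted (encode σ) i n ≡ 1) → cleared (encode σ) k ≡ 1
  cleared≡1-allRefuted σ k k<∣σ∣ refuted≡1 = cong₂ _∸_ (sg-dropCode-long k σ k<∣σ∣)
    (∑<-≡0 (suc k) λ i i<1+k → ∑<-≡0 (suc k) λ n n<1+k → cong (1 ∸_) (refuted≡1 (≤-pred i<1+k) (≤-pred n<1+k)))

  cleared-mono : ∀ {σ τ} k → σ ⪯ τ → cleared (encode σ) k ≤ cleared (encode τ) k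
  cleared-mono {σ} {τ} k σ⪯τ with length σ ≤? k
  ... | yes ∣σ∣≤k = subst (_≤ cleared (encode τ) k) (sym (cleared≡0-beyond σ k ∣σ∣≤k)) z≤n
  ... | no  ∣σ∣≰k = ∸-mono
    (≤-reflexive (trans (sg-dropCode-long k σ k<∣σ∣) (sym (sg-dropCode-long k τ (≤-trans k<∣σ∣ (⪯-length σ⪯τ))))))
    (∑<-monoʳ-≤ (suc k) λ i i<1+k → ∑<-monoʳ-≤ (suc k) λ n _ →
      ∸-monoʳ-≤ 1 (refuted-mono i n (encode-mono σ⪯τ) (sameTake (≤-trans (≤-pred i<1+k) (<⇒≤ k<∣σ∣)))))
    where
    k<∣σ∣ : k < length σ
    k<∣σ∣ = ≰⇒> ∣σ∣≰k
    sameTake : ∀ {i} → i ≤ length σ → takeCode i (encode σ) ≡ takeCode i (encode τ)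
    sameTake {i} i≤∣σ∣ = trans (takeCode-encode i σ i≤∣σ∣) (trans (cong encode (sym (take-⪯ i σ⪯τ i≤∣σ∣)))
      (sym (takeCode-encode i τ (≤-trans i≤∣σ∣ (⪯-length σ⪯τ)))))

  clearedBelow-mono : ∀ {σ τ} → σ ⪯ τ → clearedBelow (encode σ) ≤ clearedBelow (encode τ)
  clearedBelow-mono {σ} {τ} σ⪯τ = ≤-trans (∑<-monoʳ-≤ (encode σ) (λ k _ → cleared-mono k σ⪯τ))
                                          (∑<-monoˡ-≤ (cleared (encode τ)) (encode-mono σ⪯τ))

  clearedBelow-bounded : ∀ X {i w} → (∀ m → r (encode (X ↾ i)) w m ≡ 0) →
    ∀ l → clearedBelow (encode (X ↾ l)) ≤ i + w
  clearedBelow-bounded X {i} {w} unrefutable l = ∑<-≤support (i + w) c (cleared≤1 c) late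
    where
    c = encode (X ↾ l)
    late : ∀ k → i + w ≤ k → cleared c k ≡ 0
    late k i+w≤k with l ≤? k
    ... | yes l≤k = cleared≡0-beyond (X ↾ l) k (subst (_≤ k) (sym (length-↾ X l)) l≤k)
    ... | no  l≰k = cleared≡0-unrefuted c i≤k (≤-trans (m≤n+m w i) i+w≤k) (refuted≡0-noCounterexample c i w λ m →
                      subst (λ a → r a w m ≡ 0) (sym (takeCode-↾ X (≤-trans i≤k (<⇒≤ (≰⇒> l≰k))))) (unrefutable m))
      where
      i≤k : i ≤ k
      i≤k = ≤-trans (m≤m+n i w) i+w≤k

  clearedBelow-unbounded : ∀ X → (∀ i n → ∃ λ m → r (encode (X ↾ i)) n m ≢ 0) →
    ∀ K → ∃ λ l → K ≤ clearedBelow (encode (X ↾ l))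
  clearedBelow-unbounded X refutable K = l , (begin
      K                       ≡⟨ ∑<-≡bound K (λ k k<K → clearedEarly k k<K) ⟨
      ∑[ k < K ] cleared c k  ≤⟨ ∑<-monoˡ-≤ (cleared c) (≤-trans (m≤m+n K B) l≤c) ⟩
      clearedBelow c          ∎)
    where
    open ≤-Reasoning
    μ : ℕ → ℕ → ℕ
    μ i n = proj₁ (refutable i n)
    B = ∑[ i < K ] ∑[ n < K ] suc (μ i n)
    l = K + B
    c = encode (X ↾ l)
    l≤c : l ≤ c
    l≤c = subst (_≤ c) (length-↾ X l) (length≤encode (X ↾ l))
    μ<c : ∀ {i n} → i < K → n < K → μ i n < c
    μ<c {i} i<K n<K = ≤-trans (term≤∑< (λ n → suc (μ i n)) n<K)
      (≤-trans (term≤∑< (λ i → ∑[ n < K ] suc (μ i n)) i<K) (≤-trans (m≤n+m B K) l≤c))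
    clearedEarly : ∀ k → k < K → cleared c k ≡ 1
    clearedEarly k k<K = cleared≡1-allRefuted (X ↾ l) k (subst (k <_) (sym (length-↾ X l)) k<l) λ {i} {n} i≤k n≤k →
      refuted≡1-counterexample {i = i} (μ<c (≤-<-trans i≤k k<K) (≤-<-trans n≤k k<K))
        (subst (λ a → r a n (μ i n) ≢ 0) (sym (takeCode-↾ X (≤-trans i≤k (<⇒≤ k<l)))) (proj₂ (refutable i n)))
      where
      k<l : k < l
      k<l = ≤-trans k<K (m≤m+n K B)

  module _ (rᶜ : Computable 3 (r $ⁿ_)) where

    refutedᶜ : Computable 3 (λ { (c ∷ i ∷ n ∷ []) → refuted c i n })
    refutedᶜ = computable-ext (λ { (c ∷ i ∷ n ∷ []) → refl })
      (sgᶜ ∘ᶜ (∑ᶜ (rᶜ ∘ᶜ (takeCodeᶜ ∘ᶜ (πᶜ (# 2) ∷ πᶜ (# 1) ∷ []) ∷ πᶜ (# 3) ∷ πᶜ (# 0) ∷ []))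
                ∘ᶜ (πᶜ (# 0) ∷ πᶜ (# 0) ∷ πᶜ (# 1) ∷ πᶜ (# 2) ∷ []) ∷ []))

    pendingᶜ : Computable 2 (λ { (c ∷ k ∷ []) → pending c k })
    pendingᶜ = computable-ext (λ { (c ∷ k ∷ []) → refl })
      (∑ᶜ (∑ᶜ (∸ᶜ ∘ᶜ (oneᶜ ∷ refutedᶜ ∘ᶜ (πᶜ (# 2) ∷ πᶜ (# 1) ∷ πᶜ (# 0) ∷ []) ∷ []))
             ∘ᶜ (sucᶜ ∘ᶜ (πᶜ (# 2) ∷ []) ∷ πᶜ (# 0) ∷ πᶜ (# 1) ∷ πᶜ (# 2) ∷ []))
       ∘ᶜ (sucᶜ ∘ᶜ (πᶜ (# 1) ∷ []) ∷ πᶜ (# 0) ∷ πᶜ (# 1) ∷ []))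

    clearedᶜ : Computable 2 (λ { (c ∷ k ∷ []) → cleared c k })
    clearedᶜ = computable-ext (λ { (c ∷ k ∷ []) → refl })
      (∸ᶜ ∘ᶜ (sgᶜ ∘ᶜ (dropCodeᶜ ∘ᶜ (πᶜ (# 1) ∷ πᶜ (# 0) ∷ []) ∷ []) ∷ pendingᶜ ∷ []))

    opaque
      outputᶜ : Computable 1 (λ { (c ∷ []) → 2 ^ clearedBelow c ∸ 1 })
      outputᶜ = computable-ext (λ { (c ∷ []) → refl })
        (∸ᶜ ∘ᶜ (2^ᶜ ∘ᶜ (∑ᶜ (clearedᶜ ∘ᶜ (πᶜ (# 1) ∷ πᶜ (# 0) ∷ [])) ∘ᶜ (πᶜ (# 0) ∷ πᶜ (# 0) ∷ []) ∷ []) ∷ oneᶜ ∷ []))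

    output : Str → Str
    output σ = replicate (clearedBelow (encode σ)) false

    output-runs : ∀ σ → program outputᶜ [ σ ]↓ output σ
    output-runs σ = subst (program outputᶜ ⟨ encode σ ∷ [] ⟩↓_) (sym (encode-replicate (clearedBelow (encode σ))))
                          (runs outputᶜ (encode σ ∷ []))

    output-mono : ∀ {σ τ} → σ ⪯ τ → output σ ⪯ output τ
    output-mono σ⪯τ = replicate-⪯ false (clearedBelow-mono σ⪯τ)

    N : MonotoneMachine
    N = machine (program outputᶜ) output output-runs output-mono

    N-infinite⇔ : ∀ X → OutputInfinite N X ⇔ (∀ K → ∃ λ l → K ≤ clearedBelow (encode (X ↾ l)))
    N-infinite⇔ X = mk⇔
      (λ inf K → case to inf K of λ { (l , K≤) → l , subst (K ≤_) (length-replicate _) K≤ })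
      (λ unbounded → from λ K → case unbounded K of λ { (l , K≤) → l , subst (K ≤_) (sym (length-replicate _)) K≤ })
      where open Equivalence (machine-infinite⇔ (program outputᶜ) output output-runs output-mono X)

module Σ⁰₂-Membership {U : Str → Set} {R : PR 3} (R-total : Total R)
  (U⇔ : ∀ σ → U σ ⇔ (∃ λ n → ∀ m → R ⟨ encode σ ∷ n ∷ m ∷ [] ⟩↓ 0)) where

  value : ℕ → ℕ → ℕ → ℕ
  value a n m = proj₁ (R-total (a ∷ n ∷ m ∷ []))

  valueᶜ : Computable 3 (value $ⁿ_)
  valueᶜ = record { program = R ; runs = λ { (a ∷ n ∷ m ∷ []) → proj₂ (R-total (a ∷ n ∷ m ∷ [])) } }

  member⇒unrefutable : ∀ {σ} → U σ → ∃ λ n → ∀ m → value (encode σ) n m ≡ 0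
  member⇒unrefutable {σ} u with Equivalence.to (U⇔ σ) u
  ... | n , R↓0 = n , λ m → ↓-functional R (proj₂ (R-total _)) (R↓0 m)

  nonmember⇒refutable : ExcludedMiddle 0ℓ → ∀ {σ} → ¬ U σ → ∀ n → ∃ λ m → value (encode σ) n m ≢ 0
  nonmember⇒refutable em {σ} ¬u n with em {∃ λ m → value (encode σ) n m ≢ 0}
  ... | yes refutable = refutable
  ... | no  ¬refutable = ⊥-elim (¬u (Equivalence.from (U⇔ σ) (n , λ m →
          subst (R ⟨ encode σ ∷ n ∷ m ∷ [] ⟩↓_) (value≡0 m) (proj₂ (R-total _)))))
    where
    value≡0 : ∀ m → value (encode σ) n m ≡ 0
    value≡0 m with value (encode σ) n m ≟ 0
    ... | yes v≡0 = v≡0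
    ... | no  v≢0 = ⊥-elim (¬refutable (m , v≢0))

lemma3p2 : ExcludedMiddle 0ℓ → (U : Str → Set) → IsΣ⁰₂ U →
    Σ MonotoneMachine λ N → ∀ (X : Cantor) → OutputInfinite N X ⇔ NoPrefixIn U X
lemma3p2 em U (R , R-total , U⇔) = N valueᶜ , λ X → mk⇔ (infinite⇒noPrefix X) (noPrefix⇒infinite X)
  where
  open Σ⁰₂-Membership R-total U⇔
  open Stages value

  infinite⇒noPrefix : ∀ X → OutputInfinite (N valueᶜ) X → NoPrefixIn U X
  infinite⇒noPrefix X infinite i u with member⇒unrefutable u
  ... | w , unrefutable with Equivalence.to (N-infinite⇔ valueᶜ X) infinite (suc (i + w))
  ... | l , i+w<output = <⇒≱ i+w<output (clearedBelow-bounded X unrefutable l)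

  noPrefix⇒infinite : ∀ X → NoPrefixIn U X → OutputInfinite (N valueᶜ) X
  noPrefix⇒infinite X noPrefix = Equivalence.from (N-infinite⇔ valueᶜ X)
    (clearedBelow-unbounded X λ i → nonmember⇒refutable em (noPrefix i))
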